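{- Let $G$ be a simple, connected, undirected graph with vertex set $V=\{1,\ldots,n\}$ and let $\mathscr{M}$ be its family of maximal independent sets. Then: (1) if $G$ has a complete maximal independent set, then the intervals $[A\setminus Int(A);A\cup Ext(A)]$, $A\in\mathscr{M}$, do not form a partition of $2^V$; (2) if $G$ has two distinct internally complete sets, then these intervals do not form a partition of $2^V$.
   Context: The labels give the linear order on $V$; $N(v)$ is the neighbourhood of $v$. For an independent set $A$: $Ext(A)=\{v\in V\setminus A:\ \exists a\in A,\ a\in N(v),\ v>a\}$; for $v\in A$, $Subs(v)=\{u\in N(v): (A\setminus\{v\})\cup\{u\}\text{ independent}\}$, and $v$ is internally active if $Subs(v)=\emptyset$ or $v>\max Subs(v)$; $Int(A)$ is the set of internally active vertices of $A$. A maximal independent set $S$ is internally complete if $Int(S)=S$, and complete if moreover $Ext(S)=V\setminus S$. $[X;Y]=\{Z: X\subseteq Z\subseteq Y\}$. The intervals form a partition if they are pairwise disjoint (for distinct $A\in\mathscr{M}$) and their union is $2^V$. -}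

module Defs where

open import Data.Nat using (ℕ)
open import Data.Bool using (Bool; true; false; T)
open import Data.Fin using (Fin; _<_)
open import Data.Fin.Subset using (Subset; _∈_; _∉_; _⊆_)
open import Data.List using (List; []; _∷_)
open import Data.Product using (_×_; ∃-syntax; Σ-syntax)
open import Data.Sum using (_⊎_)
open import Relation.Nullary using (¬_)
open import Relation.Binary.PropositionalEquality using (_≡_)

-- A graph on V = Fin n (vertex i of Fin n is the paper's vertex i+1;
-- the linear order is the usual order on Fin n), given by a Boolean
-- adjacency function.
record Graph (n : ℕ) : Set where
  field
    adj : Fin n → Fin n → Bool

open Graph public

Adj : ∀ {n} → Graph n → Fin n → Fin n → Set
Adj G u v = T (adj G u v)

IsSimple : ∀ {n} → Graph n → Set
IsSimple G = (∀ u v → Adj G u v → Adj G v u) × (∀ v → ¬ Adj G v v)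

Walk : ∀ {n} → Graph n → Fin n → List (Fin n) → Fin n → Set
Walk G u [] v = u ≡ v
Walk G u (w ∷ ws) v = Adj G u w × Walk G w ws v

IsConnected : ∀ {n} → Graph n → Set
IsConnected G = ∀ u v → ∃[ ws ] Walk G u ws v

module _ {n : ℕ} (G : Graph n) where

  Independent : Subset n → Set
  Independent A = ∀ u v → u ∈ A → v ∈ A → ¬ Adj G u v

  MaximalIndependent : Subset n → Set
  MaximalIndependent A =
    Independent A × (∀ B → Independent B → A ⊆ B → B ≡ A)

  Swap : Subset n → Fin n → Fin n → Fin n → Set
  Swap A v u x = (x ∈ A × ¬ (x ≡ v)) ⊎ x ≡ u

  SwapIndependent : Subset n → Fin n → Fin n → Set
  SwapIndependent A v u =
    ∀ x y → Swap A v u x → Swap A v u y → ¬ Adj G x y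

  InExt : Subset n → Fin n → Set
  InExt A v = v ∉ A × (∃[ a ] (a ∈ A × Adj G a v × a < v))

  InSubs : Subset n → Fin n → Fin n → Set
  InSubs A v u = Adj G v u × SwapIndependent A v u

  -- v is internally active: Subs(v) = ∅ or v > max Subs(v),
  -- i.e. every element of Subs(v) is smaller than v
  InternallyActive : Subset n → Fin n → Set
  InternallyActive A v = ∀ u → InSubs A v u → u < v

  InInt : Subset n → Fin n → Set
  InInt A v = v ∈ A × InternallyActive A v

  InternallyComplete : Subset n → Set
  InternallyComplete S = MaximalIndependent S × (∀ v → v ∈ S → InInt S v)

  Complete : Subset n → Set
  Complete S = InternallyComplete S × (∀ v → v ∉ S → InExt S v)

  InInterval : Subset n → Subset n → Set
  InInterval A Z =
    (∀ x → x ∈ A → ¬ InInt A x → x ∈ Z) ×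
    (∀ x → x ∈ Z → x ∈ A ⊎ InExt A x)

  IntervalsPartition : Set
  IntervalsPartition =
    (∀ Z → ∃[ A ] (MaximalIndependent A × InInterval A Z)) ×
    (∀ A B Z → MaximalIndependent A → MaximalIndependent B →
       InInterval A Z → InInterval B Z → A ≡ B)

-- The interval of an internally complete S has lower end S ∖ Int(S) = ∅, so two
-- distinct such sets have overlapping intervals. If S is moreover complete, its
-- interval is all of 2^V; since G has an edge, some v lies outside S, and a maximal
-- independent A ∋ v lies in its own interval and in that of S, although A ≠ S.
module Submission where

open import Defs
open import Data.Nat using (ℕ; _≤_; suc; s≤s)
open import Data.Fin using (Fin; zero; suc)
open import Data.Fin.Subset using (Subset; _∈_; _∉_; _⊆_; _⊂_; _⊃_; _∪_; ⁅_⁆; ⊥)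
open import Data.Fin.Subset.Properties
  using (_∈?_; x∈⁅x⁆; x∈⁅y⁆⇒x≡y; x∈p∪q⁻; p⊆p∪q; q⊆p∪q; ⊆-antisym; ∉⊥)
open import Data.Fin.Subset.Induction using (Acc; acc; ⊃-wellFounded)
open import Data.Fin.Properties using (any?; all?)
open import Data.Bool.Properties using (T?)
open import Data.List using ([]; _∷_)
open import Data.Product using (_×_; ∃-syntax; _,_; proj₁; proj₂)
open import Data.Sum using (_⊎_; inj₁; inj₂)
open import Data.Empty using (⊥-elim)
open import Relation.Nullary using (¬_; Dec; yes; no; ¬?; contradiction)
open import Relation.Nullary.Decidable using (_×-dec_; _→-dec_)
open import Relation.Binary.PropositionalEquality using (_≡_; _≢_; subst)

∉⇒⊂∪⁅⁆ : ∀ {n} {A : Subset n} {x} → x ∉ A → A ⊂ A ∪ ⁅ x ⁆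
∉⇒⊂∪⁅⁆ {A = A} {x} x∉A = p⊆p∪q ⁅ x ⁆ , x , q⊆p∪q A ⁅ x ⁆ (x∈⁅x⁆ x) , x∉A

module _ {n : ℕ} (G : Graph n) where

  ∈-interval-self : ∀ A → InInterval G A A
  ∈-interval-self A = (λ x x∈A _ → x∈A) , (λ x x∈A → inj₁ x∈A)

  internallyComplete⇒∈interval : ∀ {S} → InternallyComplete G S →
    ∀ Z → (∀ x → x ∈ Z → x ∈ S ⊎ InExt G S x) → InInterval G S Z
  internallyComplete⇒∈interval (_ , active) Z Z⊆S∪Ext =
    (λ x x∈S inactive → ⊥-elim (inactive (active x x∈S))) , Z⊆S∪Ext

  internallyComplete⇒⊥∈interval : ∀ {S} → InternallyComplete G S → InInterval G S ⊥
  internallyComplete⇒⊥∈interval ic =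
    internallyComplete⇒∈interval ic ⊥ (λ x x∈⊥ → ⊥-elim (∉⊥ x∈⊥))

  complete⇒∈interval : ∀ {S} → Complete G S → ∀ Z → InInterval G S Z
  complete⇒∈interval {S} (ic , ext) Z =
    internallyComplete⇒∈interval ic Z λ x _ → member-or-external x
    where
    member-or-external : ∀ x → x ∈ S ⊎ InExt G S x
    member-or-external x with x ∈? S
    ... | yes x∈S = inj₁ x∈S
    ... | no x∉S = inj₂ (ext x x∉S)

  connected⇒neighbour : IsConnected G → ∀ {u v} → u ≢ v → ∃[ w ] Adj G u w
  connected⇒neighbour conn {u} {v} u≢v with conn u v
  ... | [] , u≡v = contradiction u≡v u≢v
  ... | w ∷ _ , u~w , _ = w , u~w

  independent⇒∃∉ : ∀ {S u w} → Independent G S → Adj G u w → ∃[ v ] v ∉ S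
  independent⇒∃∉ {S} {u} {w} ind u~w with u ∈? S
  ... | no u∉S = u , u∉S
  ... | yes u∈S = w , λ w∈S → ind u w u∈S w∈S u~w

  Addable : Subset n → Fin n → Set
  Addable A x = x ∉ A × (∀ y → y ∈ A → ¬ Adj G x y)

  addable? : ∀ A x → Dec (Addable A x)
  addable? A x = ¬? (x ∈? A) ×-dec all? (λ y → (y ∈? A) →-dec ¬? (T? (adj G x y)))

  unaddable⇒maximal : ∀ {A} → Independent G A → (∀ x → ¬ Addable A x) →
                      MaximalIndependent G A
  unaddable⇒maximal {A} ind none = ind , λ B indB A⊆B → ⊆-antisym (B⊆A B indB A⊆B) A⊆B
    where
    B⊆A : ∀ B → Independent G B → A ⊆ B → B ⊆ A
    B⊆A B indB A⊆B {y} y∈B with y ∈? A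
    ... | yes y∈A = y∈A
    ... | no y∉A = ⊥-elim (none y (y∉A , λ z z∈A → indB y z y∈B (A⊆B z∈A)))

  module _ (simple : IsSimple G) where

    private
      symmetric = proj₁ simple
      loopless = proj₂ simple

    singleton-independent : ∀ v → Independent G ⁅ v ⁆
    singleton-independent v x y x∈ y∈
      rewrite x∈⁅y⁆⇒x≡y v x∈ | x∈⁅y⁆⇒x≡y v y∈ = loopless v

    ∪-addable-independent : ∀ {A x} → Independent G A → Addable A x →
                            Independent G (A ∪ ⁅ x ⁆)
    ∪-addable-independent {A} {x} ind (_ , x≁A) u v u∈ v∈
      with x∈p∪q⁻ A ⁅ x ⁆ u∈ | x∈p∪q⁻ A ⁅ x ⁆ v∈
    ... | inj₁ u∈A | inj₁ v∈A = ind u v u∈A v∈A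
    ... | inj₁ u∈A | inj₂ v∈x rewrite x∈⁅y⁆⇒x≡y x v∈x = λ u~x → x≁A u u∈A (symmetric u x u~x)
    ... | inj₂ u∈x | inj₁ v∈A rewrite x∈⁅y⁆⇒x≡y x u∈x = x≁A v v∈A
    ... | inj₂ u∈x | inj₂ v∈x rewrite x∈⁅y⁆⇒x≡y x u∈x | x∈⁅y⁆⇒x≡y x v∈x = loopless x

    extend-to-maximal : ∀ {A} → Independent G A → ∃[ B ] (MaximalIndependent G B × A ⊆ B)
    extend-to-maximal {A} = go A (⊃-wellFounded A)
      where
      go : ∀ A → Acc _⊃_ A → Independent G A → ∃[ B ] (MaximalIndependent G B × A ⊆ B)
      go A (acc rec) ind with any? (addable? A)
      ... | no none = A , unaddable⇒maximal ind (λ x a → none (x , a)) , λ a → a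
      ... | yes (x , addable@(x∉A , _)) =
        let B , maxB , A∪x⊆B = go (A ∪ ⁅ x ⁆) (rec (∉⇒⊂∪⁅⁆ x∉A)) (∪-addable-independent ind addable)
        in B , maxB , λ a → A∪x⊆B (p⊆p∪q ⁅ x ⁆ a)

    complete⇒¬partition : IsConnected G → ∀ {u v} → u ≢ v →
                          ∀ {S} → Complete G S → ¬ IntervalsPartition G
    complete⇒¬partition conn u≢v {S} complete@((maxS , _) , _) (_ , disjoint)
      with _ , u~w ← connected⇒neighbour conn u≢v
      with v , v∉S ← independent⇒∃∉ (proj₁ maxS) u~w
      with A , maxA , ⁅v⁆⊆A ← extend-to-maximal (singleton-independent v) =
      let A≡S = disjoint A S A maxA maxS (∈-interval-self A) (complete⇒∈interval complete A)
      in v∉S (subst (v ∈_) A≡S (⁅v⁆⊆A (x∈⁅x⁆ v)))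

  internallyComplete-unique : IntervalsPartition G → ∀ {S T} →
    InternallyComplete G S → InternallyComplete G T → S ≡ T
  internallyComplete-unique (_ , disjoint) icS icT =
    disjoint _ _ ⊥ (proj₁ icS) (proj₁ icT)
      (internallyComplete⇒⊥∈interval icS) (internallyComplete⇒⊥∈interval icT)

theorem5 : ∀ (n : ℕ) → 2 ≤ n → (G : Graph n) → IsSimple G → IsConnected G →
    ((∃[ S ] Complete G S) → ¬ IntervalsPartition G) ×
    ((∃[ S ] ∃[ T ] (InternallyComplete G S × InternallyComplete G T × ¬ S ≡ T))
    → ¬ IntervalsPartition G)
theorem5 (suc (suc _)) (s≤s (s≤s _)) G simple conn =
  (λ (_ , complete) → complete⇒¬partition G simple conn zero≢one complete) ,
  (λ (_ , _ , icS , icT , S≢T) partition →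
     S≢T (internallyComplete-unique G partition icS icT))
  where
  zero≢one : ∀ {m} → zero {suc m} ≢ suc zero
  zero≢one ()
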